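{- Let $n\geq 7$ and let $G$ be an edge-colored $K^{(3)}_n$ containing no rainbow copy of $\mathcal{L}$. Then $G$ contains no rainbow copy of $C^{(3)}_3$, of $S^{(3)}_3$, or of $S^{(3)}_2\cup S^{(3)}_1$.
   Context: A copy is rainbow if its edges have pairwise distinct colors. $K^{(3)}_n$ is the complete 3-uniform hypergraph on $n$ vertices. $\mathcal{L}$ has edges $\{v_1v_2v_3,v_3v_4v_5,v_5v_6v_7\}$. $C^{(3)}_3$ has edges $\{v_1v_2v_3,v_3v_4v_5,v_5v_6v_1\}$. $S^{(3)}_3$ has edges $\{v_0v_1v_2,v_0v_3v_4,v_0v_5v_6\}$. $S^{(3)}_2\cup S^{(3)}_1$ is the vertex-disjoint union of $S^{(3)}_2$ (edges $\{v_0v_1v_2,v_0v_3v_4\}$) and a single edge, i.e. it has 8 vertices and edges $\{v_0v_1v_2,v_0v_3v_4,w_1w_2w_3\}$ (all listed vertices distinct). -}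

module Defs where

open import Data.Nat using (ℕ)
open import Data.Fin using (Fin; zero; suc)
open import Data.Fin using (#_)
open import Data.Product using (Σ; _×_; _,_)
open import Relation.Binary.PropositionalEquality using (_≡_; _≢_)
open import Function.Definitions using (Injective)

-- An edge-coloring of the complete 3-uniform hypergraph K^(3)_n with colors
-- from C: a colour for every triple of vertices, invariant under permuting
-- the triple (so it is a function of the 3-set {x,y,z}).  Values on triples
-- with repeated vertices are irrelevant (they are never used below).
record EdgeColoring (n : ℕ) (C : Set) : Set where
  field
    col   : Fin n → Fin n → Fin n → C
    sym₁₂ : ∀ x y z → col x y z ≡ col y x z
    sym₂₃ : ∀ x y z → col x y z ≡ col x z y
open EdgeColoring public

record Hypergraph3 : Set where
  field
    nv    : ℕ
    ne    : ℕ
    edge  : Fin ne → Fin nv × Fin nv × Fin nv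
open Hypergraph3 public

imgCol : ∀ {n C} → EdgeColoring n C → (H : Hypergraph3) →
         (Fin (nv H) → Fin n) → Fin (ne H) → C
imgCol G H f e with edge H e
... | (a , b , c) = col G (f a) (f b) (f c)

RainbowCopy : ∀ {n C} → EdgeColoring n C → Hypergraph3 → Set
RainbowCopy {n} G H =
  Σ (Fin (nv H) → Fin n) λ f →
    Injective _≡_ _≡_ f ×
    (∀ (e e′ : Fin (ne H)) → e ≢ e′ → imgCol G H f e ≢ imgCol G H f e′)

-- Linear path 𝓛 : edges v1v2v3, v3v4v5, v5v6v7 (vertices renamed v1..v7 ↦ 0..6)
LEdges : Fin 3 → Fin 7 × Fin 7 × Fin 7
LEdges zero             = (# 0 , # 1 , # 2)
LEdges (suc zero)       = (# 2 , # 3 , # 4)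
LEdges (suc (suc zero)) = (# 4 , # 5 , # 6)

L : Hypergraph3
L = record { nv = 7 ; ne = 3 ; edge = LEdges }

-- C^(3)_3 : edges v1v2v3, v3v4v5, v5v6v1 (renamed v1..v6 ↦ 0..5)
CEdges : Fin 3 → Fin 6 × Fin 6 × Fin 6
CEdges zero             = (# 0 , # 1 , # 2)
CEdges (suc zero)       = (# 2 , # 3 , # 4)
CEdges (suc (suc zero)) = (# 4 , # 5 , # 0)

C3 : Hypergraph3
C3 = record { nv = 6 ; ne = 3 ; edge = CEdges }

SEdges : Fin 3 → Fin 7 × Fin 7 × Fin 7
SEdges zero             = (# 0 , # 1 , # 2)
SEdges (suc zero)       = (# 0 , # 3 , # 4)
SEdges (suc (suc zero)) = (# 0 , # 5 , # 6)

S3 : Hypergraph3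
S3 = record { nv = 7 ; ne = 3 ; edge = SEdges }

-- S^(3)_2 ∪ S^(3)_1 : edges v0v1v2, v0v3v4, w1w2w3 (w1,w2,w3 ↦ 5,6,7)
S21Edges : Fin 3 → Fin 8 × Fin 8 × Fin 8
S21Edges zero             = (# 0 , # 1 , # 2)
S21Edges (suc zero)       = (# 0 , # 3 , # 4)
S21Edges (suc (suc zero)) = (# 5 , # 6 , # 7)

S2∪S1 : Hypergraph3
S2∪S1 = record { nv = 8 ; ne = 3 ; edge = S21Edges }

{-# OPTIONS --safe #-}

-- Every rainbow S₃ or S₂ ∪ S₁ yields a rainbow C₃, so C₃ is the heart of the matter.
-- In a rainbow S₃ with arms v₀v₁v₂, v₀v₃v₄, v₀v₅v₆ the edge v₁v₃v₅ closes a C₃ with any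
-- two arms, and its colour agrees with that of at most one arm. In a rainbow S₂ ∪ S₁ the
-- edge v₁v₃w₁ is the middle edge of a linear path from either star edge to w₁w₂w₃, so it
-- has the colour of w₁w₂w₃ and closes a rainbow C₃ with the two star edges.
-- Finally, take a rainbow C₃ v₁v₂v₃, v₃v₄v₅, v₅v₆v₁ and a seventh vertex w. Pairs of
-- linear paths force four edges through w to colours of the cycle; after that, v₂v₃v₄ is
-- the end edge of three linear paths whose other two edges carry all three pairs of cycle
-- colours, which is impossible.

module Submission where

open import Defs
open import Agda.Builtin.FromNat using (Number; fromNat)
open import Data.Empty using (⊥)
open import Data.Fin using (Fin; suc; _≟_; _≤?_)
import Data.Fin.Literals as Fin
open import Data.Fin.Patterns using (0F; 1F; 2F)
open import Data.Fin.Properties using (any?; all?; ¬∀⟶∃¬; injective⇒≤)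
open import Data.Nat using (ℕ; _<_; _≥_)
import Data.Nat.Literals as ℕ
open import Data.Nat.Properties using (<⇒≱)
open import Data.Product using (_×_; _,_; proj₁; proj₂; ∃; map₂)
open import Data.Unit using (tt)
open import Data.Vec using (Vec; []; _∷_; lookup)
open import Data.Vec.Relation.Unary.AllPairs using (allPairs?)
open import Data.Vec.Relation.Unary.Unique.Propositional using (Unique)
open import Data.Vec.Relation.Unary.Unique.Propositional.Properties using (lookup-injective)
import Data.Vec.Functional as Vector
open import Function using (_∘_)
open import Function.Definitions using (Injective)
import Function.Construct.Composition as Compose
open import Relation.Binary.PropositionalEquality
  using (_≡_; _≢_; refl; sym; trans; cong; ≢-sym; module ≡-Reasoning)
open import Relation.Nullary using (¬_; Dec; yes; no; ¬?; contradiction)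
open import Relation.Nullary.Decidable using (True; toWitness; decidable-stable)

instance
  ℕ-number : Number ℕ
  ℕ-number = ℕ.number

  Fin-number : ∀ {n} → Number (Fin n)
  Fin-number = Fin.number _

outside-image : ∀ {m n} → m < n → (f : Fin m → Fin n) → ∃ λ y → ∀ x → f x ≢ y
outside-image {m} m<n f with any? (λ y → all? (λ x → ¬? (f x ≟ y)))
... | yes outside = outside
... | no  ¬outside = contradiction (injective⇒≤ preimage-injective) (<⇒≱ m<n)
  where
  preimage : ∀ y → ∃ λ x → f x ≡ y
  preimage y = map₂ (λ {x} → decidable-stable (f x ≟ y))
                    (¬∀⟶∃¬ m _ (λ x → ¬? (f x ≟ y)) (¬outside ∘ (y ,_)))

  preimage-injective : Injective _≡_ _≡_ (proj₁ ∘ preimage)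
  preimage-injective {y} {y′} eq =
    trans (sym (proj₂ (preimage y))) (trans (cong f eq) (proj₂ (preimage y′)))

∷-injective : ∀ {m n} {w : Fin n} {f : Fin m → Fin n} →
              (∀ x → f x ≢ w) → Injective _≡_ _≡_ f → Injective _≡_ _≡_ (w Vector.∷ f)
∷-injective w∉f f-inj {0F}    {0F}    _     = refl
∷-injective w∉f f-inj {0F}    {suc j} w≡fj  = contradiction (sym w≡fj) (w∉f j)
∷-injective w∉f f-inj {suc i} {0F}    fi≡w  = contradiction fi≡w (w∉f i)
∷-injective w∉f f-inj {suc i} {suc j} fi≡fj = cong suc (f-inj fi≡fj)

unique? : ∀ {k m} (v : Vec (Fin k) m) → Dec (Unique v)
unique? = allPairs? (λ x y → ¬? (x ≟ y))

distinct⇒lookup-injective : ∀ {k m} {v : Vec (Fin k) m} → True (unique? v) →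
                            Injective _≡_ _≡_ (lookup v)
distinct⇒lookup-injective distinct {i} {j} = lookup-injective (toWitness distinct) i j

ordered : ∀ {k} → Fin k → Fin k → Fin k × Fin k
ordered x y with x ≤? y
... | yes _ = x , y
... | no  _ = y , x

sort3 : ∀ {k} → Fin k → Fin k → Fin k → Fin k × Fin k × Fin k
sort3 x y z =
  let (x₁ , y₁) = ordered x y
      (y₂ , z₂) = ordered y₁ z
      (x₃ , y₃) = ordered x₁ y₂
  in  x₃ , y₃ , z₂

module _ {C : Set} where

  Rainbow3 : C → C → C → Set
  Rainbow3 x y z = x ≢ y × x ≢ z × y ≢ z

  ¬Rainbow3-swap₁₂ : ∀ {x y z} → ¬ Rainbow3 x y z → ¬ Rainbow3 y x z
  ¬Rainbow3-swap₁₂ ¬rainbow (y≢x , y≢z , x≢z) = ¬rainbow (≢-sym y≢x , x≢z , y≢z)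

  Rainbow3-resp : ∀ {x x′ y y′ z z′} → x ≡ x′ → y ≡ y′ → z ≡ z′ →
                  Rainbow3 x y z → Rainbow3 x′ y′ z′
  Rainbow3-resp refl refl refl rainbow = rainbow

  -- Colours need not have decidable equality; as every goal below is ⊥,
  -- equality up to double negation is all the case analysis needs.
  _≈_ : C → C → Set
  x ≈ y = ¬ x ≢ y

  ≈-refl : ∀ {x} → x ≈ x
  ≈-refl x≢x = x≢x refl

  ≈-≢-trans : ∀ {x y z} → x ≈ y → y ≢ z → x ≢ z
  ≈-≢-trans x≈y y≢z x≡z = x≈y (λ x≡y → y≢z (trans (sym x≡y) x≡z))

  Among : C → C → C → Set
  Among x p q = ¬ (x ≢ p × x ≢ q)

  ¬Rainbow3⇒Among : ∀ {x y z p q} → p ≢ q → y ≈ p → z ≈ q → ¬ Rainbow3 x y z → Among x p q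
  ¬Rainbow3⇒Among p≢q y≈p z≈q ¬rainbow (x≢p , x≢q) =
    ¬rainbow ( ≢-sym (≈-≢-trans y≈p (≢-sym x≢p))
             , ≢-sym (≈-≢-trans z≈q (≢-sym x≢q))
             , ≈-≢-trans y≈p (≢-sym (≈-≢-trans z≈q (≢-sym p≢q))) )

  Among-intersect : ∀ {x p q r} → p ≢ r → Among x p q → Among x r q → x ≈ q
  Among-intersect p≢r x∈pq x∈rq x≢q =
    x∈pq ((λ x≡p → x∈rq ((λ x≡r → p≢r (trans (sym x≡p) x≡r)) , x≢q)) , x≢q)

  Among-pigeonhole : ∀ {x p q r} → Rainbow3 p q r →
                     Among x p q → Among x p r → Among x q r → ⊥
  Among-pigeonhole {x = x} {r = r} (p≢q , p≢r , q≢r) x∈pq x∈pr x∈qr =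
    x∈pq (≈-≢-trans x≈r (≢-sym p≢r) , ≈-≢-trans x≈r (≢-sym q≢r))
    where
    x≈r : x ≈ r
    x≈r = Among-intersect p≢q x∈pr x∈qr

Rainbow3⇒distinct : ∀ {C : Set} (c : Fin 3 → C) → Rainbow3 (c 0) (c 1) (c 2) →
                    ∀ e e′ → e ≢ e′ → c e ≢ c e′
Rainbow3⇒distinct c (c₀≢c₁ , c₀≢c₂ , c₁≢c₂) = distinct
  where
  distinct : ∀ e e′ → e ≢ e′ → c e ≢ c e′
  distinct 0F 0F e≢e′ = contradiction refl e≢e′
  distinct 0F 1F _    = c₀≢c₁
  distinct 0F 2F _    = c₀≢c₂
  distinct 1F 0F _    = ≢-sym c₀≢c₁
  distinct 1F 1F e≢e′ = contradiction refl e≢e′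
  distinct 1F 2F _    = c₁≢c₂
  distinct 2F 0F _    = ≢-sym c₀≢c₂
  distinct 2F 1F _    = ≢-sym c₁≢c₂
  distinct 2F 2F e≢e′ = contradiction refl e≢e′

module _ {n k : ℕ} {C : Set} (G : EdgeColoring n C) (E : Fin 3 → Fin k × Fin k × Fin k) where

  private
    H : Hypergraph3
    H = record { nv = k ; ne = 3 ; edge = E }

  RainbowCopy⇒Rainbow3 : ((f , _ , _) : RainbowCopy G H) →
                         Rainbow3 (imgCol G H f 0) (imgCol G H f 1) (imgCol G H f 2)
  RainbowCopy⇒Rainbow3 (_ , _ , rainbow) =
    rainbow 0 1 (λ ()) , rainbow 0 2 (λ ()) , rainbow 1 2 (λ ())

  ¬RainbowCopy⇒¬Rainbow3 : ¬ RainbowCopy G H → (f : Fin k → Fin n) → Injective _≡_ _≡_ f →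
                           ¬ Rainbow3 (imgCol G H f 0) (imgCol G H f 1) (imgCol G H f 2)
  ¬RainbowCopy⇒¬Rainbow3 ¬copy f f-inj rainbow =
    ¬copy (f , f-inj , Rainbow3⇒distinct (imgCol G H f) rainbow)

restrict : ∀ {n k C} → EdgeColoring n C → (Fin k → Fin n) → EdgeColoring k C
restrict G h = record
  { col   = λ x y z → col G (h x) (h y) (h z)
  ; sym₁₂ = λ x y z → sym₁₂ G (h x) (h y) (h z)
  ; sym₂₃ = λ x y z → sym₂₃ G (h x) (h y) (h z)
  }

restrict-¬RainbowCopy : ∀ {n k C} (G : EdgeColoring n C) (H : Hypergraph3) {h : Fin k → Fin n} →
                        Injective _≡_ _≡_ h → ¬ RainbowCopy G H → ¬ RainbowCopy (restrict G h) H
restrict-¬RainbowCopy G H h-inj ¬copy (f , f-inj , rainbow) =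
  ¬copy (_ , Compose.injective _≡_ _≡_ _≡_ f-inj h-inj , rainbow)

module _ {k : ℕ} {C : Set} (G : EdgeColoring k C) where

  -- col at the sorted triple, so that all orderings of the same literal vertices
  -- give definitionally equal colours.
  colour : Fin k → Fin k → Fin k → C
  colour x y z = let (x′ , y′ , z′) = sort3 x y z in col G x′ y′ z′

  private
    col-ordered₁₂ : ∀ x y z → col G (proj₁ (ordered x y)) (proj₂ (ordered x y)) z ≡ col G x y z
    col-ordered₁₂ x y z with x ≤? y
    ... | yes _ = refl
    ... | no  _ = sym₁₂ G y x z

    col-ordered₂₃ : ∀ x y z → col G x (proj₁ (ordered y z)) (proj₂ (ordered y z)) ≡ col G x y z
    col-ordered₂₃ x y z with y ≤? z
    ... | yes _ = refl
    ... | no  _ = sym₂₃ G x z y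

  colour≡col : ∀ x y z → colour x y z ≡ col G x y z
  colour≡col x y z = begin
    col G x₃ y₃ z₂  ≡⟨ col-ordered₁₂ x₁ y₂ z₂ ⟩
    col G x₁ y₂ z₂  ≡⟨ col-ordered₂₃ x₁ y₁ z ⟩
    col G x₁ y₁ z   ≡⟨ col-ordered₁₂ x y z ⟩
    col G x y z     ∎
    where
    open ≡-Reasoning
    x₁ y₁ y₂ z₂ x₃ y₃ : Fin k
    x₁ = proj₁ (ordered x y)
    y₁ = proj₂ (ordered x y)
    y₂ = proj₁ (ordered y₁ z)
    z₂ = proj₂ (ordered y₁ z)
    x₃ = proj₁ (ordered x₁ y₂)
    y₃ = proj₂ (ordered x₁ y₂)

module NoRainbowL {k : ℕ} {C : Set} (G : EdgeColoring k C) (¬L : ¬ RainbowCopy G L) where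

  path : ∀ a b c d e f g → {True (unique? (a ∷ b ∷ c ∷ d ∷ e ∷ f ∷ g ∷ []))} →
         ¬ Rainbow3 (colour G a b c) (colour G c d e) (colour G e f g)
  path a b c d e f g {distinct} =
    ¬RainbowCopy⇒¬Rainbow3 G LEdges ¬L _ (distinct⇒lookup-injective distinct)
    ∘ Rainbow3-resp (colour≡col G a b c) (colour≡col G c d e) (colour≡col G e f g)

module NoRainbowC3 {k : ℕ} {C : Set} (G : EdgeColoring k C) (¬C3 : ¬ RainbowCopy G C3) where

  cycle : ∀ a b c d e f → {True (unique? (a ∷ b ∷ c ∷ d ∷ e ∷ f ∷ []))} →
          ¬ Rainbow3 (colour G a b c) (colour G c d e) (colour G e f a)
  cycle a b c d e f {distinct} =
    ¬RainbowCopy⇒¬Rainbow3 G CEdges ¬C3 _ (distinct⇒lookup-injective distinct)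
    ∘ Rainbow3-resp (colour≡col G a b c) (colour≡col G c d e) (colour≡col G e f a)

C3-free-K₇ : ∀ {C} (G : EdgeColoring 7 C) → ¬ RainbowCopy G L →
                   ¬ Rainbow3 (colour G 1 2 3) (colour G 3 4 5) (colour G 5 6 1)
C3-free-K₇ {C} G ¬L rainbow@(α≢β , α≢γ , β≢γ) =
  Among-pigeonhole rainbow
    (¬Rainbow3⇒Among α≢β c₀₄₅≈α c₀₁₆≈β (path 2 3 4 5 0 1 6))
    (¬Rainbow3⇒Among α≢γ c₀₄₅≈α ≈-refl (path 2 3 4 0 5 6 1))
    (¬Rainbow3⇒Among β≢γ c₀₂₆≈β ≈-refl (path 3 4 2 0 6 5 1))
  where
  open NoRainbowL G ¬L

  α β γ : C
  α = colour G 1 2 3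
  β = colour G 3 4 5
  γ = colour G 5 6 1

  c₀₂₄≈γ : colour G 0 2 4 ≈ γ
  c₀₂₄≈γ = Among-intersect (≢-sym α≢β)
    (¬Rainbow3⇒Among β≢γ ≈-refl ≈-refl (path 0 2 4 3 5 6 1))
    (¬Rainbow3⇒Among α≢γ ≈-refl ≈-refl (path 0 4 2 3 1 5 6))

  c₀₁₆≈β : colour G 0 1 6 ≈ β
  c₀₁₆≈β = Among-intersect α≢γ
    (¬Rainbow3⇒Among α≢β ≈-refl ≈-refl (path 0 6 1 2 3 4 5))
    (¬Rainbow3⇒Among (≢-sym β≢γ) c₀₂₄≈γ ≈-refl (path 1 6 0 2 4 3 5))

  c₀₂₆≈β : colour G 0 2 6 ≈ β
  c₀₂₆≈β = Among-intersect α≢γ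
    (¬Rainbow3⇒Among α≢β ≈-refl ≈-refl (path 0 6 2 1 3 4 5))
    (¬Rainbow3⇒Among (≢-sym β≢γ) ≈-refl ≈-refl (path 0 2 6 1 5 3 4))

  c₀₄₅≈α : colour G 0 4 5 ≈ α
  c₀₄₅≈α = Among-intersect β≢γ
    (¬Rainbow3⇒Among (≢-sym α≢β) c₀₂₆≈β ≈-refl (path 4 5 0 6 2 1 3))
    (¬Rainbow3⇒Among (≢-sym α≢γ) ≈-refl ≈-refl (path 0 4 5 6 1 2 3))

module _ {n : ℕ} {C : Set} (G : EdgeColoring n C) where

  C3-free : n ≥ 7 → ¬ RainbowCopy G L → ¬ RainbowCopy G C3
  C3-free n≥7 ¬L copy@(f , f-inj , _) with outside-image n≥7 f
  ... | w , w∉f =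
    C3-free-K₇ (restrict G h) (restrict-¬RainbowCopy G L h-inj ¬L)
      (Rainbow3-resp refl refl (sym (colour≡col (restrict G h) 5 6 1))
        (RainbowCopy⇒Rainbow3 G CEdges copy))
    where
    h : Fin 7 → Fin n
    h = w Vector.∷ f
    h-inj : Injective _≡_ _≡_ h
    h-inj = ∷-injective w∉f f-inj

  S3-free : ¬ RainbowCopy G C3 → ¬ RainbowCopy G S3
  S3-free ¬C3 copy@(f , f-inj , _) with RainbowCopy⇒Rainbow3 G SEdges copy
  ... | rainbow@(α≢β , α≢γ , β≢γ) =
    Among-pigeonhole rainbow
      (¬Rainbow3⇒Among α≢β ≈-refl ≈-refl (cycle 3 5 1 2 0 4))
      (¬Rainbow3⇒Among α≢γ ≈-refl ≈-refl (cycle 5 3 1 2 0 6))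
      (¬Rainbow3⇒Among β≢γ ≈-refl ≈-refl (cycle 5 1 3 4 0 6))
    where
    open NoRainbowC3 (restrict G f) (restrict-¬RainbowCopy G C3 f-inj ¬C3)

  S2∪S1-free : ¬ RainbowCopy G L → ¬ RainbowCopy G C3 → ¬ RainbowCopy G S2∪S1
  S2∪S1-free ¬L ¬C3 copy@(f , f-inj , _) with RainbowCopy⇒Rainbow3 G S21Edges copy
  ... | α≢β , α≢γ , β≢γ =
    cycle 3 5 1 2 0 4 (≈-≢-trans y≈γ (≢-sym α≢γ) , ≈-≢-trans y≈γ (≢-sym β≢γ) , α≢β)
    where
    G′ : EdgeColoring 8 C
    G′ = restrict G f
    open NoRainbowL G′ (restrict-¬RainbowCopy G L f-inj ¬L)
    open NoRainbowC3 G′ (restrict-¬RainbowCopy G C3 f-inj ¬C3)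

    y≈γ : colour G′ 1 3 5 ≈ colour G′ 5 6 7
    y≈γ = Among-intersect α≢β
      (¬Rainbow3⇒Among α≢γ ≈-refl ≈-refl (¬Rainbow3-swap₁₂ (path 0 2 1 3 5 6 7)))
      (¬Rainbow3⇒Among β≢γ ≈-refl ≈-refl (¬Rainbow3-swap₁₂ (path 0 4 3 1 5 6 7)))

lemma4p1 : (n : ℕ) → n ≥ 7 → (C : Set) → (G : EdgeColoring n C) →
    ¬ RainbowCopy G L →
    ¬ RainbowCopy G C3 × ¬ RainbowCopy G S3 × ¬ RainbowCopy G S2∪S1
lemma4p1 n n≥7 C G ¬L = ¬C3 , S3-free G ¬C3 , S2∪S1-free G ¬L ¬C3
  where
  ¬C3 : ¬ RainbowCopy G C3
  ¬C3 = C3-free G n≥7 ¬L
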